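{- Let $G=(A,O)$ be a Manna-Pnueli game with arena $A=(V,E)$ and objective $O=(\Gamma,\gamma,\varphi)$, where each event of $\Gamma$ occurs in at most one atom of $\varphi$. Let $\Gamma_\mathsf{F},\Gamma_\mathsf{G}$ be the events occurring in atoms $\mathsf{F}\,a$, resp. $\mathsf{G}\,a$, $\Gamma_{\mathsf{F},\mathsf{G}}=\Gamma_\mathsf{F}\cup\Gamma_\mathsf{G}$, and $\Gamma_{\mathsf{EL}}$ the remaining events of $\varphi$. Let $\mathsf{upd}(v,L)=((L\cap\gamma(v))\cap\Gamma_\mathsf{G})\cup((L\cup\gamma(v))\cap\Gamma_\mathsf{F})$ for $v\in V$, $L\subseteq\Gamma_{\mathsf{F},\mathsf{G}}$; let $A'=(V',E')$ with $V'=V\times 2^{\Gamma_{\mathsf{F},\mathsf{G}}}$, $E'(v,L)=E(v)\times\{\mathsf{upd}(v,L)\}$, $(v,L)$ owned by the owner of $v$; and $\gamma'(v,L)=(\gamma(v)\cap\Gamma_{\mathsf{EL}})\cup L$. For $L\subseteq\Gamma_{\mathsf{F},\mathsf{G}}$ let $\varphi_L$ be obtained from $\varphi$ by replacing each atom $\mathsf{F}\,a$, $\mathsf{G}\,a$ by $\top$ if $a\in L$ and $\bot$ otherwise. Let $\varphi_2=\bigvee_{L\subseteq\Gamma_{\mathsf{F},\mathsf{G}}}\big(\bigwedge_{a\in L}\mathsf{GF}\,a\land\varphi_L\big)$ and $G_2=(A',(\Gamma,\gamma',\varphi_2))$. Then $G$ and $G_2$ are equivalent: for every $v\in V$, the system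 player wins $v$ in $G$ if and only if the system player wins $(v,\Gamma_\mathsf{G})$ in $G_2$.
   Context: A game arena $A=(V,E)$ is a finite directed graph with $E(v)\neq\emptyset$ for all $v$, nodes partitioned into system and environment nodes. A play is an infinite path; a system strategy maps each finite play ending in a system node to a successor of its last node. An MP objective $(\Gamma,\gamma,\varphi)$ on $V$ has a finite event set $\Gamma$ ($|\Gamma|\le|V|$), a labeling $\gamma:V\to 2^\Gamma$, and a positive Boolean formula $\varphi$ over atoms $\mathsf{GF}\,a,\mathsf{FG}\,a,\mathsf{F}\,a,\mathsf{G}\,a$; a play $v_0v_1\ldots$ satisfies $\mathsf{F}\,a$ iff $a\in\gamma(v_j)$ for some $j$, $\mathsf{G}\,a$ iff for all $j$, $\mathsf{GF}\,a$ iff for infinitely many $j$, $\mathsf{FG}\,a$ iff for all but finitely many $j$. An EL objective uses only $\mathsf{GF},\mathsf{FG}$ atoms. The system player wins a node $v$ if it has a strategy such that every compatible play from $v$ satisfies the objective formula. -}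

module Defs where

open import Data.Nat using (ℕ; zero; suc; _≤_)
open import Data.Fin using (Fin)
open import Data.Fin.Subset using (Subset; _∩_; _∪_; _⊆_; _∈_; inside; outside)
open import Data.Fin.Subset.Properties using (p∩q⊆q; p⊆p∪q; q⊆p∪q; x∈p∪q⁻; _⊆?_)
open import Data.Vec using (Vec; []; _∷_; lookup; tabulate)
open import Data.List using (List; []; _∷_; map; _++_; foldr; filter; allFin)
open import Data.Bool using (Bool; true; false; if_then_else_; _∨_)
open import Data.Product using (Σ; ∃; _×_; _,_; proj₁; proj₂)
open import Data.Sum using (_⊎_; inj₁; inj₂)
open import Data.Fin using (_≟_)
open import Relation.Nullary using (does)
open import Relation.Binary.PropositionalEquality using (_≡_; refl)

data Player : Set where
  system environment : Player

record Arena : Set₁ where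
  field
    V     : Set
    E     : V → V → Set
    owner : V → Player
    total : ∀ v → Σ V (E v)

record FinArena (n : ℕ) : Set where
  field
    E     : Fin n → Fin n → Bool
    owner : Fin n → Player
    total : ∀ v → Σ (Fin n) (λ w → E v w ≡ true)

toArena : ∀ {n} → FinArena n → Arena
toArena {n} A = record
  { V = Fin n ; E = λ v w → FinArena.E A v w ≡ true
  ; owner = FinArena.owner A ; total = FinArena.total A }

module _ (A : Arena) where
  open Arena A

  data FinPlay : V → Set where
    start : (v : V) → FinPlay v
    step  : ∀ {u w} → FinPlay u → E u w → FinPlay w

  record Play : Set where
    field
      node : ℕ → V
      edge : ∀ i → E (node i) (node (suc i))

  prefix : (ρ : Play) → (i : ℕ) → FinPlay (Play.node ρ i)
  prefix ρ zero    = start (Play.node ρ zero)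
  prefix ρ (suc i) = step (prefix ρ i) (Play.edge ρ i)

  Strategy : Set
  Strategy = ∀ {v} → FinPlay v → owner v ≡ system → Σ V (E v)

  Compatible : Strategy → Play → Set
  Compatible σ ρ = ∀ i → (s : owner (Play.node ρ i) ≡ system) →
    Play.node ρ (suc i) ≡ proj₁ (σ (prefix ρ i) s)

data Atom (k : ℕ) : Set where
  GF FG F G : Fin k → Atom k

data Formula (k : ℕ) : Set where
  ⊤ᶠ ⊥ᶠ : Formula k
  atom  : Atom k → Formula k
  _∧ᶠ_ _∨ᶠ_ : Formula k → Formula k → Formula k

record Objective (V : Set) : Set where
  field
    k : ℕ                      -- Γ = Fin k
    γ : V → Subset k
    φ : Formula k

module _ {A : Arena} (O : Objective (Arena.V A)) where
  open Objective O

  SatAtom : Atom k → Play A → Set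
  SatAtom (F a)  ρ = ∃ λ j → a ∈ γ (Play.node ρ j)
  SatAtom (G a)  ρ = ∀ j → a ∈ γ (Play.node ρ j)
  SatAtom (GF a) ρ = ∀ i → ∃ λ j → i ≤ j × a ∈ γ (Play.node ρ j)
  SatAtom (FG a) ρ = ∃ λ i → ∀ j → i ≤ j → a ∈ γ (Play.node ρ j)

  SatF : Formula k → Play A → Set
  SatF ⊤ᶠ ρ = Data.Unit.⊤ where import Data.Unit
  SatF ⊥ᶠ ρ = Data.Empty.⊥ where import Data.Empty
  SatF (atom x) ρ = SatAtom x ρ
  SatF (ψ ∧ᶠ χ) ρ = SatF ψ ρ × SatF χ ρ
  SatF (ψ ∨ᶠ χ) ρ = SatF ψ ρ ⊎ SatF χ ρ

  Sat : Play A → Set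
  Sat = SatF φ

Wins : (A : Arena) → Objective (Arena.V A) → Arena.V A → Set
Wins A O v = Σ (Strategy A) λ σ → (ρ : Play A) →
  Play.node ρ zero ≡ v → Compatible A σ ρ → Sat O ρ

atoms : ∀ {k} → Formula k → List (Atom k)
atoms ⊤ᶠ = []
atoms ⊥ᶠ = []
atoms (atom x) = x ∷ []
atoms (ψ ∧ᶠ χ) = atoms ψ ++ atoms χ
atoms (ψ ∨ᶠ χ) = atoms ψ ++ atoms χ

event : ∀ {k} → Atom k → Fin k
event (GF a) = a
event (FG a) = a
event (F a)  = a
event (G a)  = a

open import Data.List.Membership.Propositional renaming (_∈_ to _∈ˡ_)

EventsInAtMostOneAtom : ∀ {k} → Formula k → Set
EventsInAtMostOneAtom φ = ∀ x y → x ∈ˡ atoms φ → y ∈ˡ atoms φ →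
  event x ≡ event y → x ≡ y

isF isG isEL : ∀ {k} → Fin k → Atom k → Bool
isF a (F b) = does (a ≟ b)
isF a _     = false
isG a (G b) = does (a ≟ b)
isG a _     = false
isEL a (GF b) = does (a ≟ b)
isEL a (FG b) = does (a ≟ b)
isEL a _      = false

anyL : ∀ {k} → (Atom k → Bool) → List (Atom k) → Bool
anyL p = foldr (λ x b → p x ∨ b) false

ΓF ΓG ΓEL ΓFG : ∀ {k} → Formula k → Subset k
ΓF  φ = tabulate (λ a → anyL (isF a) (atoms φ))
ΓG  φ = tabulate (λ a → anyL (isG a) (atoms φ))
ΓEL φ = tabulate (λ a → anyL (isEL a) (atoms φ))
ΓFG φ = ΓF φ ∪ ΓG φ

substL : ∀ {k} → Subset k → Formula k → Formula k
substL L ⊤ᶠ = ⊤ᶠ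
substL L ⊥ᶠ = ⊥ᶠ
substL L (atom (F a)) = if lookup L a then ⊤ᶠ else ⊥ᶠ
substL L (atom (G a)) = if lookup L a then ⊤ᶠ else ⊥ᶠ
substL L (atom (GF a)) = atom (GF a)
substL L (atom (FG a)) = atom (FG a)
substL L (ψ ∧ᶠ χ) = substL L ψ ∧ᶠ substL L χ
substL L (ψ ∨ᶠ χ) = substL L ψ ∨ᶠ substL L χ

allSubsets : ∀ k → List (Subset k)
allSubsets zero = [] ∷ []
allSubsets (suc k) = map (inside ∷_) (allSubsets k) ++ map (outside ∷_) (allSubsets k)

bigAndGF : ∀ {k} → Subset k → Formula k
bigAndGF {k} L = foldr (λ a ψ → if lookup L a then atom (GF a) ∧ᶠ ψ else ψ) ⊤ᶠ (allFin k)

φ₂ : ∀ {k} → Formula k → Formula k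
φ₂ φ = foldr (λ L ψ → (bigAndGF L ∧ᶠ substL L φ) ∨ᶠ ψ) ⊥ᶠ
             (filter (λ L → L ⊆? ΓFG φ) (allSubsets _))

module Construction {n : ℕ} (A : FinArena n) (O : Objective (Fin n)) where
  open Objective O
  open FinArena A

  upd : Fin n → Subset k → Subset k
  upd v L = ((L ∩ γ v) ∩ ΓG φ) ∪ ((L ∪ γ v) ∩ ΓF φ)

  upd⊆ : ∀ v L → upd v L ⊆ ΓFG φ
  upd⊆ v L x∈ with x∈p∪q⁻ ((L ∩ γ v) ∩ ΓG φ) _ x∈
  ... | inj₁ p = q⊆p∪q (ΓF φ) (ΓG φ) (p∩q⊆q (L ∩ γ v) (ΓG φ) p)
  ... | inj₂ p = p⊆p∪q (ΓG φ) (p∩q⊆q (L ∪ γ v) (ΓF φ) p)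

  SubFG : Set
  SubFG = Σ (Subset k) (λ L → L ⊆ ΓFG φ)

  A′ : Arena
  A′ = record
    { V = Fin n × SubFG
    ; E = λ { (v , L) (w , L′) → (E v w ≡ true) × (proj₁ L′ ≡ upd v (proj₁ L)) }
    ; owner = λ { (v , _) → owner v }
    ; total = λ { (v , L) → (proj₁ (total v) , upd v (proj₁ L) , upd⊆ v (proj₁ L))
                           , proj₂ (total v) , refl } }

  γ′ : Fin n × SubFG → Subset k
  γ′ (v , L) = (γ v ∩ ΓEL φ) ∪ proj₁ L

  O₂ : Objective (Arena.V A′)
  O₂ = record { k = k ; γ = γ′ ; φ = φ₂ φ }

  ΓG⊆ΓFG : ΓG φ ⊆ ΓFG φ
  ΓG⊆ΓFG = q⊆p∪q (ΓF φ) (ΓG φ)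

module Submission where

-- The memory L of a node (v , L) of A′ records which F-events have occurred so far and
-- which G-events have held at every step so far, whence the initial memory Γ_G. As each
-- event occurs in a single atom, the memory of an F-event only grows and that of a
-- G-event only shrinks. Hence along a play F a holds iff a is eventually always in memory,
-- and G a iff a is always in memory; either way iff a is infinitely often in memory, i.e.
-- GF a holds for γ′. So a play satisfies φ iff its lifting satisfies the disjunct of φ₂
-- for L the set of F- and G-atoms that hold. The memory is a function of the history, so a
-- strategy in G is played on first components in G₂, and a strategy in G₂ is simulated in G
-- by recomputing the memory along the history.

open import Defs
open import Data.Nat using (ℕ; zero; suc; _+_; _≤_; _≤′_; ≤′-refl; ≤′-step)
open import Data.Nat.Properties using (≤-refl; m≤m+n; m≤n+m; ≤⇒≤′)
open import Data.Fin using (Fin; _≟_)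
open import Data.Fin.Subset using (Subset; _∩_; _∪_; _⊆_; _∈_; _∉_; ⁅_⁆; inside; outside)
  renaming (⊥ to ∅)
open import Data.Fin.Subset.Properties
  using (x∈p∩q⁺; x∈p∩q⁻; x∈p∪q⁺; x∈p∪q⁻; p⊆p∪q; q⊆p∪q; _⊆?_; x∈⁅x⁆; x∈⁅y⁆⇒x≡y; ∉⊥)
open import Data.Vec using ([]; _∷_; tabulate; lookup)
open import Data.Vec.Properties using ([]=⇒lookup; lookup⇒[]=; lookup∘tabulate)
open import Data.List using (List; []; _∷_; map; foldr; filter; allFin)
open import Data.List.Relation.Unary.Any using (here; there)
open import Data.List.Membership.Propositional using () renaming (_∈_ to _∈ˡ_)
open import Data.List.Membership.Propositional.Properties
  using (∈-map⁺; ∈-++⁺ˡ; ∈-++⁺ʳ; ∈-filter⁺; ∈-allFin)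
open import Data.List.Relation.Binary.Subset.Propositional using () renaming (_⊆_ to _⊆ˡ_)
open import Data.List.Relation.Binary.Subset.Propositional.Properties
  using (⊆-trans; xs⊆xs++ys; xs⊆ys++xs)
open import Data.Bool using (Bool; true; false; if_then_else_; _∨_)
open import Data.Bool.Properties using (∨-zeroʳ)
open import Data.Product using (Σ; ∃; _×_; _,_; proj₁; proj₂)
open import Data.Sum as Sum using (_⊎_; inj₁; inj₂)
open import Data.Unit using (tt)
open import Function using (_∘_; id)
open import Function.Bundles using (_⇔_; mk⇔)
open import Relation.Nullary using (yes; no; does; contradiction)
open import Relation.Nullary.Decidable using (dec-true)
open import Relation.Binary.Definitions using (DecidableEquality)
open import Relation.Binary.PropositionalEquality using (_≡_; refl; sym; trans; cong; subst)
import Axiom.UniquenessOfIdentityProofs as UIP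

∈-tabulate⁺ : ∀ {k} (f : Fin k → Bool) {a} → f a ≡ true → a ∈ tabulate f
∈-tabulate⁺ f {a} fa = lookup⇒[]= a (tabulate f) (trans (lookup∘tabulate f a) fa)

∈-tabulate⁻ : ∀ {k} (f : Fin k → Bool) {a} → a ∈ tabulate f → f a ≡ true
∈-tabulate⁻ f {a} a∈ = trans (sym (lookup∘tabulate f a)) ([]=⇒lookup a∈)

anyL⁺ : ∀ {k} (p : Atom k → Bool) {x xs} → x ∈ˡ xs → p x ≡ true → anyL p xs ≡ true
anyL⁺ p (here refl) px rewrite px = refl
anyL⁺ p {xs = y ∷ _} (there x∈) px = trans (cong (p y ∨_) (anyL⁺ p x∈ px)) (∨-zeroʳ (p y))

anyL⁻ : ∀ {k} (p : Atom k → Bool) xs → anyL p xs ≡ true → ∃ λ x → x ∈ˡ xs × p x ≡ true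
anyL⁻ p (y ∷ ys) any≡ with p y in py
... | true  = y , here refl , py
... | false = let x , x∈ , px = anyL⁻ p ys any≡ in x , there x∈ , px

≟-sound : ∀ {k} {a b : Fin k} → does (a ≟ b) ≡ true → a ≡ b
≟-sound {a = a} {b} does≡ with a ≟ b
... | yes a≡b = a≡b
... | no _    = contradiction does≡ λ ()

isF⁻ : ∀ {k} {a : Fin k} x → isF a x ≡ true → x ≡ F a
isF⁻ (F b) isF≡ = cong F (sym (≟-sound isF≡))

isG⁻ : ∀ {k} {a : Fin k} x → isG a x ≡ true → x ≡ G a
isG⁻ (G b) isG≡ = cong G (sym (≟-sound isG≡))

isEL⁻ : ∀ {k} {a : Fin k} x → isEL a x ≡ true → x ≡ GF a ⊎ x ≡ FG a
isEL⁻ (GF b) isEL≡ = inj₁ (cong GF (sym (≟-sound isEL≡)))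
isEL⁻ (FG b) isEL≡ = inj₂ (cong FG (sym (≟-sound isEL≡)))

module Events {k} (φ : Formula k) where

  ΓF⁺ : ∀ {a} → F a ∈ˡ atoms φ → a ∈ ΓF φ
  ΓF⁺ {a} F∈ = ∈-tabulate⁺ _ (anyL⁺ (isF a) F∈ (dec-true (a ≟ a) refl))

  ΓG⁺ : ∀ {a} → G a ∈ˡ atoms φ → a ∈ ΓG φ
  ΓG⁺ {a} G∈ = ∈-tabulate⁺ _ (anyL⁺ (isG a) G∈ (dec-true (a ≟ a) refl))

  ΓEL⁺ : ∀ {a} → GF a ∈ˡ atoms φ ⊎ FG a ∈ˡ atoms φ → a ∈ ΓEL φ
  ΓEL⁺ {a} (inj₁ GF∈) = ∈-tabulate⁺ _ (anyL⁺ (isEL a) GF∈ (dec-true (a ≟ a) refl))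
  ΓEL⁺ {a} (inj₂ FG∈) = ∈-tabulate⁺ _ (anyL⁺ (isEL a) FG∈ (dec-true (a ≟ a) refl))

  ΓF⁻ : ∀ {a} → a ∈ ΓF φ → F a ∈ˡ atoms φ
  ΓF⁻ {a} a∈ with anyL⁻ (isF a) (atoms φ) (∈-tabulate⁻ _ a∈)
  ... | x , x∈ , isF≡ = subst (_∈ˡ atoms φ) (isF⁻ x isF≡) x∈

  ΓG⁻ : ∀ {a} → a ∈ ΓG φ → G a ∈ˡ atoms φ
  ΓG⁻ {a} a∈ with anyL⁻ (isG a) (atoms φ) (∈-tabulate⁻ _ a∈)
  ... | x , x∈ , isG≡ = subst (_∈ˡ atoms φ) (isG⁻ x isG≡) x∈

  ΓEL⁻ : ∀ {a} → a ∈ ΓEL φ → GF a ∈ˡ atoms φ ⊎ FG a ∈ˡ atoms φ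
  ΓEL⁻ {a} a∈ with anyL⁻ (isEL a) (atoms φ) (∈-tabulate⁻ _ a∈)
  ... | x , x∈ , isEL≡ =
    Sum.map (λ x≡ → subst (_∈ˡ atoms φ) x≡ x∈) (λ x≡ → subst (_∈ˡ atoms φ) x≡ x∈) (isEL⁻ x isEL≡)

  ΓFG⁻ : ∀ {a} → a ∈ ΓFG φ → F a ∈ˡ atoms φ ⊎ G a ∈ˡ atoms φ
  ΓFG⁻ a∈ = Sum.map ΓF⁻ ΓG⁻ (x∈p∪q⁻ (ΓF φ) (ΓG φ) a∈)

  module Disjoint (unique : EventsInAtMostOneAtom φ) where

    ΓF-ΓG-disjoint : ∀ {a} → a ∈ ΓF φ → a ∉ ΓG φ
    ΓF-ΓG-disjoint aF aG = contradiction (unique _ _ (ΓF⁻ aF) (ΓG⁻ aG) refl) λ ()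

    ΓFG-ΓEL-disjoint : ∀ {a} → a ∈ ΓFG φ → a ∉ ΓEL φ
    ΓFG-ΓEL-disjoint aFG aEL with ΓFG⁻ aFG | ΓEL⁻ aEL
    ... | inj₁ F∈ | inj₁ GF∈ = contradiction (unique _ _ F∈ GF∈ refl) λ ()
    ... | inj₁ F∈ | inj₂ FG∈ = contradiction (unique _ _ F∈ FG∈ refl) λ ()
    ... | inj₂ G∈ | inj₁ GF∈ = contradiction (unique _ _ G∈ GF∈ refl) λ ()
    ... | inj₂ G∈ | inj₂ FG∈ = contradiction (unique _ _ G∈ FG∈ refl) λ ()

_≟ᴾ_ : DecidableEquality Player
system      ≟ᴾ system      = yes refl
system      ≟ᴾ environment = no λ ()
environment ≟ᴾ system      = no λ ()
environment ≟ᴾ environment = yes refl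

allSubsets-complete : ∀ {k} (L : Subset k) → L ∈ˡ allSubsets k
allSubsets-complete [] = here refl
allSubsets-complete (true ∷ L) = ∈-++⁺ˡ (∈-map⁺ (inside ∷_) (allSubsets-complete L))
allSubsets-complete (false ∷ L) =
  ∈-++⁺ʳ (map (inside ∷_) (allSubsets _)) (∈-map⁺ (outside ∷_) (allSubsets-complete L))

module _ {A : Arena} (O : Objective (Arena.V A)) where
  open Objective O using (k; γ)

  private
    ∈γ-cong : ∀ {a u w} → u ≡ w → a ∈ γ u → a ∈ γ w
    ∈γ-cong refl a∈ = a∈

  SatF-cong : ∀ ψ {ρ₁ ρ₂ : Play A} → (∀ i → Play.node ρ₁ i ≡ Play.node ρ₂ i) →
    SatF O ψ ρ₁ → SatF O ψ ρ₂
  SatF-cong ⊤ᶠ _ _ = tt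
  SatF-cong (atom (GF a)) same sat i = let j , i≤j , a∈ = sat i in j , i≤j , ∈γ-cong (same j) a∈
  SatF-cong (atom (FG a)) same (i , sat) = i , λ j i≤j → ∈γ-cong (same j) (sat j i≤j)
  SatF-cong (atom (F a)) same (j , a∈) = j , ∈γ-cong (same j) a∈
  SatF-cong (atom (G a)) same sat j = ∈γ-cong (same j) (sat j)
  SatF-cong (ψ ∧ᶠ χ) same (sat , sat′) = SatF-cong ψ same sat , SatF-cong χ same sat′
  SatF-cong (ψ ∨ᶠ χ) same (inj₁ sat) = inj₁ (SatF-cong ψ same sat)
  SatF-cong (ψ ∨ᶠ χ) same (inj₂ sat) = inj₂ (SatF-cong χ same sat)

  module _ (ρ : Play A) where

    FG⇒GF : ∀ {a} → SatAtom O (FG a) ρ → SatAtom O (GF a) ρ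
    FG⇒GF (i₀ , always) i = i₀ + i , m≤n+m i i₀ , always (i₀ + i) (m≤m+n i₀ i)

    G⇒GF : ∀ {a} → SatAtom O (G a) ρ → SatAtom O (GF a) ρ
    G⇒GF always i = i , ≤-refl , always i

    if-∈⁺ : ∀ {L : Subset k} {a} → a ∈ L → SatF O (if lookup L a then ⊤ᶠ else ⊥ᶠ) ρ
    if-∈⁺ a∈ rewrite []=⇒lookup a∈ = tt

    if-∈⁻ : ∀ {L : Subset k} {a} → SatF O (if lookup L a then ⊤ᶠ else ⊥ᶠ) ρ → a ∈ L
    if-∈⁻ {L} {a} sat with lookup L a in lookup≡
    ... | true = lookup⇒[]= a L lookup≡

    private
      ⋀GF : Subset k → List (Fin k) → Formula k
      ⋀GF L = foldr (λ a ψ → if lookup L a then atom (GF a) ∧ᶠ ψ else ψ) ⊤ᶠ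

      ⋁ : Formula k → List (Subset k) → Formula k
      ⋁ ψ = foldr (λ L χ → (bigAndGF L ∧ᶠ substL L ψ) ∨ᶠ χ) ⊥ᶠ

    ⋀GF⁺ : ∀ {L} xs → (∀ {a} → a ∈ L → SatAtom O (GF a) ρ) → SatF O (⋀GF L xs) ρ
    ⋀GF⁺ [] _ = tt
    ⋀GF⁺ {L} (a ∷ xs) gf with lookup L a in lookup≡
    ... | true  = gf (lookup⇒[]= a L lookup≡) , ⋀GF⁺ xs gf
    ... | false = ⋀GF⁺ xs gf

    ⋀GF⁻ : ∀ {L a} xs → SatF O (⋀GF L xs) ρ → a ∈ˡ xs → a ∈ L → SatAtom O (GF a) ρ
    ⋀GF⁻ {L} (b ∷ xs) sat a∈xs a∈L with lookup L b in lookup≡ | a∈xs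
    ... | true  | here refl = proj₁ sat
    ... | true  | there a∈ = ⋀GF⁻ xs (proj₂ sat) a∈ a∈L
    ... | false | here refl = contradiction (trans (sym lookup≡) ([]=⇒lookup a∈L)) λ ()
    ... | false | there a∈ = ⋀GF⁻ xs sat a∈ a∈L

    ⋁⁺ : ∀ ψ {L} Ls → L ∈ˡ Ls → SatF O (bigAndGF L ∧ᶠ substL L ψ) ρ → SatF O (⋁ ψ Ls) ρ
    ⋁⁺ ψ (_ ∷ _)  (here refl) sat = inj₁ sat
    ⋁⁺ ψ (_ ∷ Ls) (there L∈)  sat = inj₂ (⋁⁺ ψ Ls L∈ sat)

    ⋁⁻ : ∀ ψ Ls → SatF O (⋁ ψ Ls) ρ → ∃ λ L → SatF O (bigAndGF L ∧ᶠ substL L ψ) ρ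
    ⋁⁻ ψ (L ∷ _)  (inj₁ sat) = L , sat
    ⋁⁻ ψ (_ ∷ Ls) (inj₂ sat) = ⋁⁻ ψ Ls sat

    φ₂⁺ : ∀ ψ {L} → L ⊆ ΓFG ψ → (∀ {a} → a ∈ L → SatAtom O (GF a) ρ) →
      SatF O (substL L ψ) ρ → SatF O (φ₂ ψ) ρ
    φ₂⁺ ψ {L} L⊆ gf sat =
      ⋁⁺ ψ _ (∈-filter⁺ (_⊆? ΓFG ψ) (allSubsets-complete L) L⊆) (⋀GF⁺ (allFin k) gf , sat)

    φ₂⁻ : ∀ ψ → SatF O (φ₂ ψ) ρ →
      ∃ λ L → (∀ {a} → a ∈ L → SatAtom O (GF a) ρ) × SatF O (substL L ψ) ρ
    φ₂⁻ ψ sat = let L , gf , sat′ = ⋁⁻ ψ (filter (_⊆? ΓFG ψ) (allSubsets k)) sat in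
      L , (λ a∈ → ⋀GF⁻ (allFin k) gf (∈-allFin _) a∈) , sat′

    -- The set L of φ₂ cannot be decided from the play; it is read off the proof of satisfaction.
    usedFG : (ψ : Formula k) → SatF O ψ ρ → Subset k
    usedFG ⊤ᶠ _ = ∅
    usedFG (atom (GF _)) _ = ∅
    usedFG (atom (FG _)) _ = ∅
    usedFG (atom (F a)) _ = ⁅ a ⁆
    usedFG (atom (G a)) _ = ⁅ a ⁆
    usedFG (ψ ∧ᶠ χ) (sat , sat′) = usedFG ψ sat ∪ usedFG χ sat′
    usedFG (ψ ∨ᶠ χ) (inj₁ sat) = usedFG ψ sat
    usedFG (ψ ∨ᶠ χ) (inj₂ sat) = usedFG χ sat

    usedFG-sound : ∀ {xs} ψ → atoms ψ ⊆ˡ xs → (sat : SatF O ψ ρ) → ∀ {a} → a ∈ usedFG ψ sat →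
      (F a ∈ˡ xs × SatAtom O (F a) ρ) ⊎ (G a ∈ˡ xs × SatAtom O (G a) ρ)
    usedFG-sound ⊤ᶠ _ _ a∈ = contradiction a∈ ∉⊥
    usedFG-sound (atom (GF _)) _ _ a∈ = contradiction a∈ ∉⊥
    usedFG-sound (atom (FG _)) _ _ a∈ = contradiction a∈ ∉⊥
    usedFG-sound (atom (F b)) ψ⊆ sat a∈ with x∈⁅y⁆⇒x≡y b a∈
    ... | refl = inj₁ (ψ⊆ (here refl) , sat)
    usedFG-sound (atom (G b)) ψ⊆ sat a∈ with x∈⁅y⁆⇒x≡y b a∈
    ... | refl = inj₂ (ψ⊆ (here refl) , sat)
    usedFG-sound (ψ ∧ᶠ χ) ψχ⊆ (sat , sat′) a∈ with x∈p∪q⁻ (usedFG ψ sat) _ a∈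
    ... | inj₁ a∈ψ = usedFG-sound ψ (⊆-trans (xs⊆xs++ys _ _) ψχ⊆) sat a∈ψ
    ... | inj₂ a∈χ = usedFG-sound χ (⊆-trans (xs⊆ys++xs _ _) ψχ⊆) sat′ a∈χ
    usedFG-sound (ψ ∨ᶠ χ) ψχ⊆ (inj₁ sat) a∈ = usedFG-sound ψ (⊆-trans (xs⊆xs++ys _ _) ψχ⊆) sat a∈
    usedFG-sound (ψ ∨ᶠ χ) ψχ⊆ (inj₂ sat) a∈ = usedFG-sound χ (⊆-trans (xs⊆ys++xs _ _) ψχ⊆) sat a∈

module Product {n} (A : FinArena n) (O : Objective (Fin n)) where
  open Objective O
  open FinArena A using (E; owner)
  open Construction A O
  open Events φ

  Base : Arena
  Base = toArena A

  memory : Arena.V A′ → Subset k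
  memory (_ , L , _) = L

  upd-F⁺ : ∀ {a v L} → a ∈ ΓF φ → a ∈ L ⊎ a ∈ γ v → a ∈ upd v L
  upd-F⁺ aF a∈ = x∈p∪q⁺ (inj₂ (x∈p∩q⁺ (x∈p∪q⁺ a∈ , aF)))

  upd-G⁺ : ∀ {a v L} → a ∈ ΓG φ → a ∈ L → a ∈ γ v → a ∈ upd v L
  upd-G⁺ aG a∈L a∈γ = x∈p∪q⁺ (inj₁ (x∈p∩q⁺ (x∈p∩q⁺ (a∈L , a∈γ) , aG)))

  upd⁻ : ∀ {a v L} → a ∈ upd v L →
    (a ∈ L × a ∈ γ v) × a ∈ ΓG φ ⊎ (a ∈ L ⊎ a ∈ γ v) × a ∈ ΓF φ
  upd⁻ a∈ = Sum.map
    (λ a∈G → let a∈∩ , aG = x∈p∩q⁻ _ _ a∈G in x∈p∩q⁻ _ _ a∈∩ , aG)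
    (λ a∈F → let a∈∪ , aF = x∈p∩q⁻ _ _ a∈F in x∈p∪q⁻ _ _ a∈∪ , aF)
    (x∈p∪q⁻ _ _ a∈)

  γ′-EL⁺ : ∀ {a} x → a ∈ ΓEL φ → a ∈ γ (proj₁ x) → a ∈ γ′ x
  γ′-EL⁺ _ aEL a∈ = x∈p∪q⁺ (inj₁ (x∈p∩q⁺ (a∈ , aEL)))

  γ′-memory⁺ : ∀ {a} x → a ∈ memory x → a ∈ γ′ x
  γ′-memory⁺ (v , _) a∈ = x∈p∪q⁺ {p = γ v ∩ ΓEL φ} (inj₂ a∈)

  module _ (unique : EventsInAtMostOneAtom φ) where
    open Disjoint unique

    upd-F⁻ : ∀ {a v L} → a ∈ ΓF φ → a ∈ upd v L → a ∈ L ⊎ a ∈ γ v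
    upd-F⁻ aF a∈ with upd⁻ a∈
    ... | inj₁ (_ , aG) = contradiction aG (ΓF-ΓG-disjoint aF)
    ... | inj₂ (a∈′ , _) = a∈′

    upd-G⁻ : ∀ {a v L} → a ∈ ΓG φ → a ∈ upd v L → a ∈ L × a ∈ γ v
    upd-G⁻ aG a∈ with upd⁻ a∈
    ... | inj₁ (a∈′ , _) = a∈′
    ... | inj₂ (_ , aF) = contradiction aG (ΓF-ΓG-disjoint aF)

    γ′-EL⁻ : ∀ {a} x → a ∈ ΓEL φ → a ∈ γ′ x → a ∈ γ (proj₁ x)
    γ′-EL⁻ (v , L) aEL a∈ with x∈p∪q⁻ (γ v ∩ ΓEL φ) (proj₁ L) a∈
    ... | inj₁ a∈γ = proj₁ (x∈p∩q⁻ _ _ a∈γ)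
    ... | inj₂ a∈L = contradiction aEL (ΓFG-ΓEL-disjoint (proj₂ L a∈L))

    γ′-memory⁻ : ∀ {a} x → a ∈ ΓFG φ → a ∈ γ′ x → a ∈ memory x
    γ′-memory⁻ (v , L) aFG a∈ with x∈p∪q⁻ (γ v ∩ ΓEL φ) (proj₁ L) a∈
    ... | inj₁ a∈γ = contradiction (proj₂ (x∈p∩q⁻ _ _ a∈γ)) (ΓFG-ΓEL-disjoint aFG)
    ... | inj₂ a∈L = a∈L

  project : Play A′ → Play Base
  project ρ′ = record
    { node = λ i → proj₁ (Play.node ρ′ i) ; edge = λ i → proj₁ (Play.edge ρ′ i) }

  substL⁺ : ∀ {ρ′ L} ψ → atoms ψ ⊆ˡ atoms φ → (sat : SatF O ψ (project ρ′)) →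
    usedFG O (project ρ′) ψ sat ⊆ L → SatF O₂ (substL L ψ) ρ′
  substL⁺ ⊤ᶠ _ _ _ = tt
  substL⁺ {ρ′} (atom (GF a)) ψ⊆ sat _ i =
    let j , i≤j , a∈ = sat i in j , i≤j , γ′-EL⁺ (Play.node ρ′ j) (ΓEL⁺ (inj₁ (ψ⊆ (here refl)))) a∈
  substL⁺ {ρ′} (atom (FG a)) ψ⊆ (i , sat) _ =
    i , λ j i≤j → γ′-EL⁺ (Play.node ρ′ j) (ΓEL⁺ (inj₂ (ψ⊆ (here refl)))) (sat j i≤j)
  substL⁺ {ρ′} (atom (F a)) _ _ used⊆ = if-∈⁺ O₂ ρ′ (used⊆ (x∈⁅x⁆ a))
  substL⁺ {ρ′} (atom (G a)) _ _ used⊆ = if-∈⁺ O₂ ρ′ (used⊆ (x∈⁅x⁆ a))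
  substL⁺ {ρ′} (ψ ∧ᶠ χ) ψχ⊆ (sat , sat′) used⊆ =
    substL⁺ ψ (⊆-trans (xs⊆xs++ys _ _) ψχ⊆) sat (used⊆ ∘ p⊆p∪q (usedFG O ρ χ sat′)) ,
    substL⁺ χ (⊆-trans (xs⊆ys++xs _ _) ψχ⊆) sat′ (used⊆ ∘ q⊆p∪q (usedFG O ρ ψ sat) _)
    where ρ = project ρ′
  substL⁺ (ψ ∨ᶠ χ) ψχ⊆ (inj₁ sat) used⊆ = inj₁ (substL⁺ ψ (⊆-trans (xs⊆xs++ys _ _) ψχ⊆) sat used⊆)
  substL⁺ (ψ ∨ᶠ χ) ψχ⊆ (inj₂ sat) used⊆ = inj₂ (substL⁺ χ (⊆-trans (xs⊆ys++xs _ _) ψχ⊆) sat used⊆)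

  module Memory (ρ′ : Play A′) (initial : memory (Play.node ρ′ zero) ≡ ΓG φ) where

    ρ : Play Base
    ρ = project ρ′

    v : ℕ → Fin n
    v = Play.node ρ

    mem : ℕ → Subset k
    mem i = memory (Play.node ρ′ i)

    mem-suc : ∀ i → mem (suc i) ≡ upd (v i) (mem i)
    mem-suc i = proj₂ (Play.edge ρ′ i)

    F-step : ∀ {a} i → a ∈ ΓF φ → a ∈ mem i ⊎ a ∈ γ (v i) → a ∈ mem (suc i)
    F-step i aF a∈ rewrite mem-suc i = upd-F⁺ aF a∈

    F-persists : ∀ {a i j} → a ∈ ΓF φ → i ≤′ j → a ∈ mem i → a ∈ mem j
    F-persists aF ≤′-refl a∈ = a∈
    F-persists aF (≤′-step i≤j) a∈ = F-step _ aF (inj₁ (F-persists aF i≤j a∈))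

    G⇒always-in-mem : ∀ {a} → a ∈ ΓG φ → SatAtom O (G a) ρ → ∀ i → a ∈ mem i
    G⇒always-in-mem aG _ zero rewrite initial = aG
    G⇒always-in-mem aG always (suc i) rewrite mem-suc i = upd-G⁺ aG (G⇒always-in-mem aG always i) (always i)

    F⇒FG₂ : ∀ {a} → a ∈ ΓF φ → SatAtom O (F a) ρ → SatAtom O₂ (FG a) ρ′
    F⇒FG₂ aF (j , a∈) = suc j , λ i j<i →
      γ′-memory⁺ (Play.node ρ′ i) (F-persists aF (≤⇒≤′ j<i) (F-step j aF (inj₂ a∈)))

    G⇒G₂ : ∀ {a} → a ∈ ΓG φ → SatAtom O (G a) ρ → SatAtom O₂ (G a) ρ′
    G⇒G₂ aG always i = γ′-memory⁺ (Play.node ρ′ i) (G⇒always-in-mem aG always i)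

    sat⇒sat₂ : Sat O ρ → Sat O₂ ρ′
    sat⇒sat₂ sat = φ₂⁺ O₂ ρ′ φ used⊆ΓFG usedGF (substL⁺ φ id sat id)
      where
      used : Subset k
      used = usedFG O ρ φ sat

      used⊆ΓFG : used ⊆ ΓFG φ
      used⊆ΓFG a∈ with usedFG-sound O ρ φ id sat a∈
      ... | inj₁ (F∈ , _) = p⊆p∪q (ΓG φ) (ΓF⁺ F∈)
      ... | inj₂ (G∈ , _) = q⊆p∪q (ΓF φ) (ΓG φ) (ΓG⁺ G∈)

      usedGF : ∀ {a} → a ∈ used → SatAtom O₂ (GF a) ρ′
      usedGF a∈ with usedFG-sound O ρ φ id sat a∈
      ... | inj₁ (F∈ , Fa) = FG⇒GF O₂ ρ′ (F⇒FG₂ (ΓF⁺ F∈) Fa)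
      ... | inj₂ (G∈ , Ga) = G⇒GF O₂ ρ′ (G⇒G₂ (ΓG⁺ G∈) Ga)

    module _ (unique : EventsInAtMostOneAtom φ) where
      open Disjoint unique

      F-origin : ∀ {a} i → a ∈ ΓF φ → a ∈ mem i → SatAtom O (F a) ρ
      F-origin zero aF a∈ = contradiction (subst (_ ∈_) initial a∈) (ΓF-ΓG-disjoint aF)
      F-origin (suc i) aF a∈ with upd-F⁻ unique aF (subst (_ ∈_) (mem-suc i) a∈)
      ... | inj₁ a∈mem = F-origin i aF a∈mem
      ... | inj₂ a∈γ   = i , a∈γ

      G-step⁻ : ∀ {a i} → a ∈ ΓG φ → a ∈ mem (suc i) → a ∈ mem i × a ∈ γ (v i)
      G-step⁻ {i = i} aG a∈ = upd-G⁻ unique aG (subst (_ ∈_) (mem-suc i) a∈)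

      G-mem-antitone : ∀ {a i j} → a ∈ ΓG φ → i ≤′ j → a ∈ mem j → a ∈ mem i
      G-mem-antitone aG ≤′-refl a∈ = a∈
      G-mem-antitone aG (≤′-step i≤j) a∈ = G-mem-antitone aG i≤j (proj₁ (G-step⁻ aG a∈))

      GF₂⇒F : ∀ {a} → a ∈ ΓF φ → SatAtom O₂ (GF a) ρ′ → SatAtom O (F a) ρ
      GF₂⇒F aF gf = let j , _ , a∈ = gf zero in
        F-origin j aF (γ′-memory⁻ unique (Play.node ρ′ j) (p⊆p∪q (ΓG φ) aF) a∈)

      GF₂⇒G : ∀ {a} → a ∈ ΓG φ → SatAtom O₂ (GF a) ρ′ → SatAtom O (G a) ρ
      GF₂⇒G aG gf i = let j , i<j , a∈ = gf (suc i) in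
        proj₂ (G-step⁻ aG (G-mem-antitone aG (≤⇒≤′ i<j)
          (γ′-memory⁻ unique (Play.node ρ′ j) (q⊆p∪q (ΓF φ) (ΓG φ) aG) a∈)))

      substL⁻ : ∀ {L} ψ → atoms ψ ⊆ˡ atoms φ → (∀ {a} → a ∈ L → SatAtom O₂ (GF a) ρ′) →
        SatF O₂ (substL L ψ) ρ′ → SatF O ψ ρ
      substL⁻ ⊤ᶠ _ _ _ = tt
      substL⁻ (atom (GF a)) ψ⊆ _ sat i = let j , i≤j , a∈ = sat i in
        j , i≤j , γ′-EL⁻ unique (Play.node ρ′ j) (ΓEL⁺ (inj₁ (ψ⊆ (here refl)))) a∈
      substL⁻ (atom (FG a)) ψ⊆ _ (i , sat) =
        i , λ j i≤j → γ′-EL⁻ unique (Play.node ρ′ j) (ΓEL⁺ (inj₂ (ψ⊆ (here refl)))) (sat j i≤j)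
      substL⁻ (atom (F a)) ψ⊆ gf sat = GF₂⇒F (ΓF⁺ (ψ⊆ (here refl))) (gf (if-∈⁻ O₂ ρ′ sat))
      substL⁻ (atom (G a)) ψ⊆ gf sat = GF₂⇒G (ΓG⁺ (ψ⊆ (here refl))) (gf (if-∈⁻ O₂ ρ′ sat))
      substL⁻ (ψ ∧ᶠ χ) ψχ⊆ gf (sat , sat′) =
        substL⁻ ψ (⊆-trans (xs⊆xs++ys _ _) ψχ⊆) gf sat ,
        substL⁻ χ (⊆-trans (xs⊆ys++xs _ _) ψχ⊆) gf sat′
      substL⁻ (ψ ∨ᶠ χ) ψχ⊆ gf (inj₁ sat) = inj₁ (substL⁻ ψ (⊆-trans (xs⊆xs++ys _ _) ψχ⊆) gf sat)
      substL⁻ (ψ ∨ᶠ χ) ψχ⊆ gf (inj₂ sat) = inj₂ (substL⁻ χ (⊆-trans (xs⊆ys++xs _ _) ψχ⊆) gf sat)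

      sat₂⇒sat : Sat O₂ ρ′ → Sat O ρ
      sat₂⇒sat sat = let _ , gf , sat′ = φ₂⁻ O₂ ρ′ φ sat in substL⁻ φ id gf sat′

  initial′ : Fin n → Arena.V A′
  initial′ v = v , ΓG φ , ΓG⊆ΓFG

  projectFin : ∀ {x} → FinPlay A′ x → FinPlay Base (proj₁ x)
  projectFin (start x) = start (proj₁ x)
  projectFin (step p e) = step (projectFin p) (proj₁ e)

  projectFin-prefix : ∀ ρ′ i → projectFin (prefix A′ ρ′ i) ≡ prefix Base (project ρ′) i
  projectFin-prefix ρ′ zero = refl
  projectFin-prefix ρ′ (suc i) =
    cong (λ p → step p (proj₁ (Play.edge ρ′ i))) (projectFin-prefix ρ′ i)

  module FromBase (σ : Strategy Base) where

    σ′ : Strategy A′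
    σ′ {v , L , _} p s = let w , e = σ (projectFin p) s in (w , upd v L , upd⊆ v L) , e , refl

    project-compatible : ∀ ρ′ → Compatible A′ σ′ ρ′ → Compatible Base σ (project ρ′)
    project-compatible ρ′ c i s =
      trans (cong proj₁ (c i s)) (cong (λ p → proj₁ (σ p s)) (projectFin-prefix ρ′ i))

  wins⇒wins₂ : ∀ {v} → Wins Base O v → Wins A′ O₂ (initial′ v)
  wins⇒wins₂ (σ , win) = σ′ , λ ρ′ starts c →
    Memory.sat⇒sat₂ ρ′ (cong memory starts)
      (win (project ρ′) (cong proj₁ starts) (project-compatible ρ′ c))
    where open FromBase σ

  module FromProduct (σ′ : Strategy A′) where

    updEdge : ∀ {u w} L → E u w ≡ true → Σ SubFG λ L′ → Arena.E A′ (u , L) (w , L′)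
    updEdge {u} (L , _) e = (upd u L , upd⊆ u L) , e , refl

    -- A memory carries a proof of L ⊆ Γ_{F,G}, and such proofs cannot be identified without
    -- function extensionality; so where σ′ takes the edge, its own successor node is copied.
    liftEdge : ∀ {u w L} → FinPlay A′ (u , L) → E u w ≡ true → (o : Player) → owner u ≡ o →
      Σ SubFG λ L′ → Arena.E A′ (u , L) (w , L′)
    liftEdge {L = L} q e environment _ = updEdge L e
    liftEdge {w = w} {L} q e system s with w ≟ proj₁ (proj₁ (σ′ q s))
    ... | yes refl = proj₂ (proj₁ (σ′ q s)) , proj₂ (σ′ q s)
    ... | no _     = updEdge L e

    lift : ∀ {v} → FinPlay Base v → Σ SubFG λ L → FinPlay A′ (v , L)
    lift (start v) = proj₂ (initial′ v) , start (initial′ v)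
    lift (step p e) = let L , q = lift p ; L′ , e′ = liftEdge q e _ refl in L′ , step q e′

    σ : Strategy Base
    σ p s = let (w , _) , e′ = σ′ (proj₂ (lift p)) s in w , proj₁ e′

    liftEdge-follows-σ′ : ∀ {u w L} (q : FinPlay A′ (u , L)) (e : E u w ≡ true) o (t : owner u ≡ o)
      (s : owner u ≡ system) → w ≡ proj₁ (proj₁ (σ′ q s)) →
      (w , proj₁ (liftEdge q e o t)) ≡ proj₁ (σ′ q s)
    liftEdge-follows-σ′ q e environment t s _ = contradiction (trans (sym t) s) λ ()
    liftEdge-follows-σ′ {w = w} q e system t s w≡ with UIP.Decidable⇒UIP.≡-irrelevant _≟ᴾ_ t s
    ... | refl with w ≟ proj₁ (proj₁ (σ′ q t))
    ...   | yes refl = refl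
    ...   | no w≢    = contradiction w≡ w≢

    liftPlay : Play Base → Play A′
    liftPlay ρ = record
      { node = λ i → Play.node ρ i , proj₁ (lift (prefix Base ρ i))
      ; edge = λ i → proj₂ (liftEdge (proj₂ (lift (prefix Base ρ i))) (Play.edge ρ i) _ refl) }

    prefix-liftPlay : ∀ ρ i → prefix A′ (liftPlay ρ) i ≡ proj₂ (lift (prefix Base ρ i))
    prefix-liftPlay ρ zero = refl
    prefix-liftPlay ρ (suc i) = cong (λ q → step q (Play.edge (liftPlay ρ) i)) (prefix-liftPlay ρ i)

    liftPlay-compatible : ∀ ρ → Compatible Base σ ρ → Compatible A′ σ′ (liftPlay ρ)
    liftPlay-compatible ρ c i s =
      trans (liftEdge-follows-σ′ (proj₂ (lift (prefix Base ρ i))) (Play.edge ρ i) _ refl s (c i s))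
            (cong (λ q → proj₁ (σ′ q s)) (sym (prefix-liftPlay ρ i)))

  wins₂⇒wins : EventsInAtMostOneAtom φ → ∀ {v} → Wins A′ O₂ (initial′ v) → Wins Base O v
  wins₂⇒wins unique (σ′ , win) = σ , λ ρ starts c →
    SatF-cong O φ (λ _ → refl)
      (Memory.sat₂⇒sat (liftPlay ρ) refl unique
        (win (liftPlay ρ) (cong initial′ starts) (liftPlay-compatible ρ c)))
    where open FromProduct σ′

lemma5 : (n : ℕ) (A : FinArena n) (O : Objective (Fin n)) →
    Objective.k O ≤ n →
    EventsInAtMostOneAtom (Objective.φ O) →
    (v : Fin n) →
    Wins (toArena A) O v ⇔
      Wins (Construction.A′ A O) (Construction.O₂ A O)
        (v , ΓG (Objective.φ O) , Construction.ΓG⊆ΓFG A O)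
lemma5 n A O _ unique v = mk⇔ wins⇒wins₂ (wins₂⇒wins unique)
  where open Product A O
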